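{- Let $a,c,d,e$ be indeterminates, and for parameters $(a,c,d,e)$ let $\mathbf{T}(a,c,d,e)=(T(n,k))_{n,k\ge0}$ be defined by $T(0,k)=\delta_{k0}$ and, for $n\ge1$, $T(n,k)=[a(n-k)+c]\,T(n-1,k-1)+(dk+e)\,T(n-1,k)$ (with $T(n,k)=0$ for $k<0$). (i) For $\mathbf{T}=\mathbf{T}(0,c,d,e)$ and all $n,k\ge 0$, \[ T(n,k)=\sum_{\pi\in\Pi_{n+1,k+1}}\ \prod_{i=2}^{n+1} w_\pi(i),\qquad w_\pi(i)=\begin{cases} e & \text{if } \mathrm{smallest}(\pi,i)=1,\\ c & \text{if } \mathrm{smallest}(\pi,i)=i,\\ d & \text{if } \mathrm{smallest}(\pi,i)\ne 1,i.\end{cases} \] (ii) For $\mathbf{T}=\mathbf{T}(a,c,0,e)$ and all $n,k\ge 0$, \[ T(n,k)=\sum_{\pi\in\Pi_{n+1,n+1-k}}\ \prod_{i=2}^{n+1} w_\pi(i),\qquad w_\pi(i)=\begin{cases} c & \text{if } \mathrm{smallest}(\pi,i)=1,\\ e & \text{if } \mathrm{smallest}(\pi,i)=i,\\ a & \text{if } \mathrm{smallest}(\pi,i)\ne 1,i.\end{cases} \]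
   Context: $\Pi_{n,k}$ denotes the set of partitions of $[n]=\{1,\dots,n\}$ into exactly $k$ nonempty blocks (empty if $k>n$ or $k\le 0<n$). For $\pi$ a set partition of $[n]$ and $i\in[n]$, $\mathrm{smallest}(\pi,i)$ denotes the smallest element of the block of $\pi$ containing $i$. -}

module Defs where

open import Level using (Level)
open import Data.Bool using (Bool; true; false; _∧_; _∨_; not; if_then_else_)
open import Data.Nat using (ℕ; zero; suc; _∸_; _≡ᵇ_)
open import Data.Fin using (Fin; zero; suc; toℕ)
open import Data.Fin.Properties using (_≟_)
open import Data.List using (List; []; _∷_; map; concatMap; filter; foldr; allFin; length)
open import Relation.Nullary using (does)
open import Relation.Nullary.Decidable using (isYes)
open import Algebra.Bundles using (CommutativeSemiring)

allFuns : {A : Set} (n : ℕ) → List A → List (Fin n → A)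
allFuns zero    xs = (λ ()) ∷ []
allFuns (suc n) xs =
  concatMap (λ x → map (λ f → λ { zero → x ; (suc i) → f i }) (allFuns n xs)) xs

-- A binary relation on [m] (encoded on Fin m, element j+1 of [m] is index j),
-- given by its Boolean characteristic function.
BRel : ℕ → Set
BRel m = Fin m → Fin m → Bool

allBRels : (m : ℕ) → List (BRel m)
allBRels m = allFuns m (allFuns m (true ∷ false ∷ []))

_⇒ᵇ_ : Bool → Bool → Bool
x ⇒ᵇ y = not x ∨ y

allᵇ : {A : Set} → (A → Bool) → List A → Bool
allᵇ p = foldr (λ x r → p x ∧ r) true

isEquivᵇ : {m : ℕ} → BRel m → Bool
isEquivᵇ {m} R =
  allᵇ (λ i → R i i) (allFin m)
  ∧ allᵇ (λ i → allᵇ (λ j → R i j ⇒ᵇ R j i) (allFin m)) (allFin m)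
  ∧ allᵇ (λ i → allᵇ (λ j → allᵇ (λ k → (R i j ∧ R j k) ⇒ᵇ R i k) (allFin m)) (allFin m)) (allFin m)

-- Set partitions of [m] are identified with equivalence relations on [m]
-- (the blocks are the equivalence classes).

firstRelated : {m : ℕ} → BRel m → Fin m → List (Fin m) → Fin m
firstRelated R i []       = i
firstRelated R i (j ∷ js) = if R j i then j else firstRelated R i js

smallest : {m : ℕ} → BRel m → Fin m → Fin m
smallest {m} R i = firstRelated R i (allFin m)

-- number of blocks = number of elements that are the smallest of their block
numBlocks : {m : ℕ} → BRel m → ℕ
numBlocks {m} R = length (filter (λ i → smallest R i ≟ i) (allFin m))

Partitions : (m k : ℕ) → List (BRel m)
Partitions m k = filter (λ R → (isEquivᵇ R ∧ (numBlocks R ≡ᵇ k)) Data.Bool.≟ true) (allBRels m)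
  where import Data.Bool

module _ {c ℓ : Level} (S : CommutativeSemiring c ℓ) where
  open CommutativeSemiring S using (Carrier; _+_; _*_; 0#; 1#)

  _•_ : ℕ → Carrier → Carrier
  zero  • x = 0#
  suc n • x = x + (n • x)

  -- T(a,c,d,e): T(0,k)=δ_{k0}; T(n,k) = [a(n-k)+c] T(n-1,k-1) + (dk+e) T(n-1,k)
  -- (the first term is absent for k = 0 since T(n-1,-1) = 0)
  T : (a c' d e : Carrier) → ℕ → ℕ → Carrier
  T a c' d e zero    zero    = 1#
  T a c' d e zero    (suc k) = 0#
  T a c' d e (suc n) zero    = ((0 • d) + e) * T a c' d e n zero
  T a c' d e (suc n) (suc k) =
    (((suc n ∸ suc k) • a) + c') * T a c' d e n k
    + ((suc k • d) + e) * T a c' d e n (suc k)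

  sumL : List Carrier → Carrier
  sumL = foldr _+_ 0#

  prodL : List Carrier → Carrier
  prodL = foldr _*_ 1#

  weight : {m : ℕ} → BRel m → (x y z : Carrier) → Fin m → Carrier
  weight R x y z i with smallest R i
  ... | zero = x
  ... | s = if isYes (s ≟ i) then y else z

  partitionSum : (n b : ℕ) (x y z : Carrier) → Carrier
  partitionSum n b x y z =
    sumL (map (λ R → prodL (map (λ j → weight R x y z (suc j)) (allFin n)))
              (Partitions (suc n) b))

-- Adding m+1 to a partition of [m] either as a singleton block or to one of its existing
-- blocks produces every partition of [m+1] exactly once. With weights x (element joins the
-- block of 1), y (element starts a block) and z (element joins any other block), the weighted
-- count P(n,b) of partitions of [n+1] into b blocks therefore satisfies
--   P(n+1,b+1) = y P(n,b) + (x + b z) P(n,b+1),   P(0,b) = δ_{b,1}.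
-- For (x,y,z) = (e,c,d) this is the recurrence of T(0,c,d,e) with k = b-1, and for
-- (x,y,z) = (c,e,a) that of T(a,c,0,e) with k = n+1-b.

module Submission where

open import Defs
open import Level using (Level)
open import Algebra.Bundles using (CommutativeSemiring)
open import Data.Bool using (Bool; true; false; _∧_; if_then_else_)
open import Data.Bool.Properties using (∧-conicalˡ; ∧-conicalʳ; ∧-zeroʳ; ¬-not; if-eta; if-∧)
import Data.Bool as Bool
open import Data.Fin using (Fin; zero; suc; inject₁; fromℕ)
open import Data.Fin.Properties using (_≟_; inject₁-injective; fromℕ≢inject₁; any?; all?)
open import Data.Fin.Relation.Unary.Top using (view; ‵fromℕ; ‵inject₁)
open import Data.List using (List; []; _∷_; map; concatMap; filter; allFin; length; tabulate; _++_; [_]; _∷ʳ_)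
open import Data.List.Properties
  using (map-tabulate; map-id; ++-identityʳ; filter-++; filter-≐; length-++; length-filter; length-tabulate)
open import Data.List.Relation.Unary.Any using (Any; here; there)
open import Data.List.Membership.Propositional using (_∈_; lose)
open import Data.List.Relation.Unary.AllPairs using (_∷_)
open import Data.List.Relation.Unary.All using (All; []; _∷_)
import Data.List.Relation.Unary.All.Properties as AllP
import Data.List.Relation.Unary.All as All
open import Data.List.Relation.Unary.Unique.Propositional using (Unique)
import Data.List.Relation.Unary.Unique.Propositional.Properties as Unique
open import Data.List.Membership.Propositional.Properties using (∈-allFin; ∈-filter⁺; ∈-filter⁻)
open import Data.Nat using (ℕ; zero; suc; _≡ᵇ_; _∸_; _≤_; _<_; s≤s; z≤n) renaming (_+_ to _+ℕ_)
import Data.Nat.Properties as ℕ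
open import Data.Product using (_×_; _,_; proj₂; Σ-syntax)
open import Data.Empty using (⊥)
open import Data.Sum using (_⊎_; inj₁; inj₂)
import Data.Vec.Functional as Vector
open import Data.Vec.Functional using (zipWith)
open import Function using (_∘_; _$_; id; mk⇔)
open import Relation.Binary.Core using (Rel)
open import Relation.Binary.Structures using (IsEquivalence)
open import Relation.Binary.PropositionalEquality
  using (_≡_; _≢_; _≗_; refl; sym; trans; cong; cong₂; subst; module ≡-Reasoning)
open import Relation.Nullary using (Dec; yes; no; does; ¬_; contradiction; _×-dec_)
open import Relation.Nullary.Decidable using (isYes; isYes≗does; does-⇔; dec-true; dec-false)

private
  variable
    A : Set
    m n : ℕ

snoc : (Fin n → A) → A → Fin (suc n) → A
snoc {n = zero}  f x zero    = x
snoc {n = suc n} f x zero    = f zero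
snoc {n = suc n} f x (suc i) = snoc (f ∘ suc) x i

snoc-inject₁ : (f : Fin n → A) (x : A) (i : Fin n) → snoc f x (inject₁ i) ≡ f i
snoc-inject₁ {n = suc n} f x zero    = refl
snoc-inject₁ {n = suc n} f x (suc i) = snoc-inject₁ (f ∘ suc) x i

snoc-fromℕ : (f : Fin n → A) (x : A) → snoc f x (fromℕ n) ≡ x
snoc-fromℕ {n = zero}  f x = refl
snoc-fromℕ {n = suc n} f x = snoc-fromℕ (f ∘ suc) x

snoc-pointwise : (_~_ : A → A → Set) {f g : Fin n → A} {x y : A} →
                 (∀ i → f i ~ g i) → x ~ y → ∀ i → snoc f x i ~ snoc g y i
snoc-pointwise {n = zero}  _~_ f~g x~y zero    = x~y
snoc-pointwise {n = suc n} _~_ f~g x~y zero    = f~g zero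
snoc-pointwise {n = suc n} _~_ f~g x~y (suc i) = snoc-pointwise _~_ (f~g ∘ suc) x~y i

allFin-suc-∷ʳ : ∀ n → allFin (suc n) ≡ map inject₁ (allFin n) ∷ʳ fromℕ n
allFin-suc-∷ʳ n = trans (tabulate-∷ʳ id) (cong (_∷ʳ fromℕ n) (sym (map-tabulate id inject₁)))
  where
  tabulate-∷ʳ : ∀ {n} (f : Fin (suc n) → A) → tabulate f ≡ tabulate (f ∘ inject₁) ∷ʳ f (fromℕ n)
  tabulate-∷ʳ {n = zero}  f = refl
  tabulate-∷ʳ {n = suc n} f = cong (f zero ∷_) (tabulate-∷ʳ (f ∘ suc))

length-filter-map : {B : Set} {P : B → Set} {Q : A → Set} (P? : ∀ b → Dec (P b)) (Q? : ∀ a → Dec (Q a))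
                    (g : A → B) → (∀ a → does (P? (g a)) ≡ does (Q? a)) →
                    ∀ xs → length (filter P? (map g xs)) ≡ length (filter Q? xs)
length-filter-map P? Q? g P∘g≗Q []       = refl
length-filter-map P? Q? g P∘g≗Q (a ∷ xs) with does (P? (g a)) | does (Q? a) | P∘g≗Q a
... | true  | true  | _ = cong suc (length-filter-map P? Q? g P∘g≗Q xs)
... | false | false | _ = length-filter-map P? Q? g P∘g≗Q xs

length-filter-[_] : {P : A → Set} {P? : ∀ a → Dec (P a)} (a : A) →
                    length (filter P? [ a ]) ≡ (if does (P? a) then 1 else 0)
length-filter-[_] {P? = P?} a with does (P? a)
... | true  = refl
... | false = refl

does-inject₁ : (i j : Fin n) → does (inject₁ i ≟ inject₁ j) ≡ does (i ≟ j)
does-inject₁ i j = does-⇔ (mk⇔ inject₁-injective (cong inject₁)) (inject₁ i ≟ inject₁ j) (i ≟ j)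

does-inject₁-fromℕ : (i : Fin n) → does (inject₁ i ≟ fromℕ n) ≡ false
does-inject₁-fromℕ i = dec-false (inject₁ i ≟ fromℕ _) (fromℕ≢inject₁ ∘ sym)

∧-intro : ∀ {a b} → a ≡ true → b ≡ true → a ∧ b ≡ true
∧-intro refl refl = refl

⇒ᵇ-elim : ∀ {a b} → (a ⇒ᵇ b) ≡ true → a ≡ true → b ≡ true
⇒ᵇ-elim {true} a⇒b refl = a⇒b

⇒ᵇ-intro : ∀ {a b} → (a ≡ true → b ≡ true) → (a ⇒ᵇ b) ≡ true
⇒ᵇ-intro {true}  a⇒b = a⇒b refl
⇒ᵇ-intro {false} a⇒b = refl

≡true-ext : ∀ {a b} → (a ≡ true → b ≡ true) → (b ≡ true → a ≡ true) → a ≡ b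
≡true-ext {true}          a⇒b b⇒a = sym (a⇒b refl)
≡true-ext {false} {true}  a⇒b b⇒a = b⇒a refl
≡true-ext {false} {false} a⇒b b⇒a = refl

false≢true : false ≢ true
false≢true ()

does-true⇒ : {P : Set} (p? : Dec P) → does p? ≡ true → P
does-true⇒ (yes p) _ = p

_≗?_ : (f g : Fin n → Bool) → Dec (f ≗ g)
f ≗? g = all? (λ i → f i Bool.≟ g i)

allᵇ-tabulate⁻ : (p : A → Bool) (f : Fin n → A) → allᵇ p (tabulate f) ≡ true → ∀ i → p (f i) ≡ true
allᵇ-tabulate⁻ {n = suc n} p f all zero    = ∧-conicalˡ _ _ all
allᵇ-tabulate⁻ {n = suc n} p f all (suc i) = allᵇ-tabulate⁻ p (f ∘ suc) (∧-conicalʳ _ _ all) i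

allᵇ-tabulate⁺ : (p : A → Bool) (f : Fin n → A) → (∀ i → p (f i) ≡ true) → allᵇ p (tabulate f) ≡ true
allᵇ-tabulate⁺ {n = zero}  p f all = refl
allᵇ-tabulate⁺ {n = suc n} p f all = ∧-intro (all zero) (allᵇ-tabulate⁺ p (f ∘ suc) (all ∘ suc))

allᵇ-cong : {p q : A → Bool} (xs : List A) → (∀ x → p x ≡ q x) → allᵇ p xs ≡ allᵇ q xs
allᵇ-cong []       p≗q = refl
allᵇ-cong (x ∷ xs) p≗q = cong₂ _∧_ (p≗q x) (allᵇ-cong xs p≗q)

allFinᵇ⁻ : {p : Fin n → Bool} → allᵇ p (allFin n) ≡ true → ∀ i → p i ≡ true
allFinᵇ⁻ = allᵇ-tabulate⁻ _ id

allFinᵇ⁺ : {p : Fin n → Bool} → (∀ i → p i ≡ true) → allᵇ p (allFin n) ≡ true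
allFinᵇ⁺ = allᵇ-tabulate⁺ _ id

-- Equivalence relations as Boolean relations

Holds : BRel m → Rel (Fin m) Level.zero
Holds R i j = R i j ≡ true

_≐ᵇ_ : BRel m → BRel m → Set
R ≐ᵇ R′ = ∀ i j → R i j ≡ R′ i j

IsEquivalenceᵇ : BRel m → Set
IsEquivalenceᵇ R = IsEquivalence (Holds R)

module Equiv {m} {R : BRel m} (eq : IsEquivalenceᵇ R) where
  open IsEquivalence eq public using () renaming (refl to ∼-refl; sym to ∼-sym; trans to ∼-trans)

  symmetric : ∀ i j → R i j ≡ R j i
  symmetric i j = ≡true-ext ∼-sym ∼-sym

reflexiveᵇ symmetricᵇ transitiveᵇ : BRel m → Bool
reflexiveᵇ  {m} R = allᵇ (λ i → R i i) (allFin m)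
symmetricᵇ  {m} R = allᵇ (λ i → allᵇ (λ j → R i j ⇒ᵇ R j i) (allFin m)) (allFin m)
transitiveᵇ {m} R =
  allᵇ (λ i → allᵇ (λ j → allᵇ (λ k → (R i j ∧ R j k) ⇒ᵇ R i k) (allFin m)) (allFin m)) (allFin m)

isEquivᵇ⇒IsEquivalence : (R : BRel m) → isEquivᵇ R ≡ true → IsEquivalenceᵇ R
isEquivᵇ⇒IsEquivalence R isEq = record
  { refl  = λ {i} → allFinᵇ⁻ refl-R i
  ; sym   = λ {i} {j} → ⇒ᵇ-elim (allFinᵇ⁻ (allFinᵇ⁻ sym-R i) j)
  ; trans = λ {i} {j} {k} p q → ⇒ᵇ-elim (allFinᵇ⁻ (allFinᵇ⁻ (allFinᵇ⁻ trans-R i) j) k) (∧-intro p q)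
  }
  where
  refl-R : reflexiveᵇ R ≡ true
  refl-R = ∧-conicalˡ _ _ isEq
  sym-R : symmetricᵇ R ≡ true
  sym-R = ∧-conicalˡ _ _ (∧-conicalʳ (reflexiveᵇ R) _ isEq)
  trans-R : transitiveᵇ R ≡ true
  trans-R = ∧-conicalʳ (symmetricᵇ R) _ (∧-conicalʳ (reflexiveᵇ R) _ isEq)

IsEquivalence⇒isEquivᵇ : (R : BRel m) → IsEquivalenceᵇ R → isEquivᵇ R ≡ true
IsEquivalence⇒isEquivᵇ R eq = ∧-intro refl-R (∧-intro sym-R trans-R)
  where
  open Equiv eq
  refl-R : reflexiveᵇ R ≡ true
  refl-R = allFinᵇ⁺ λ i → ∼-refl {i}
  sym-R : symmetricᵇ R ≡ true
  sym-R = allFinᵇ⁺ λ i → allFinᵇ⁺ λ j → ⇒ᵇ-intro (∼-sym {i} {j})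
  trans-R : transitiveᵇ R ≡ true
  trans-R = allFinᵇ⁺ λ i → allFinᵇ⁺ λ j → allFinᵇ⁺ λ k →
    ⇒ᵇ-intro λ p → ∼-trans {i} {j} {k} (∧-conicalˡ _ _ p) (∧-conicalʳ _ _ p)

isEquivᵇ-cong : {R R′ : BRel m} → R ≐ᵇ R′ → isEquivᵇ R ≡ isEquivᵇ R′
isEquivᵇ-cong {m} R≐R′ =
  cong₂ _∧_ (allᵇ-cong (allFin m) λ i → R≐R′ i i)
    (cong₂ _∧_
      (allᵇ-cong (allFin m) λ i → allᵇ-cong (allFin m) λ j → cong₂ _⇒ᵇ_ (R≐R′ i j) (R≐R′ j i))
      (allᵇ-cong (allFin m) λ i → allᵇ-cong (allFin m) λ j → allᵇ-cong (allFin m) λ k →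
         cong₂ _⇒ᵇ_ (cong₂ _∧_ (R≐R′ i j) (R≐R′ j k)) (R≐R′ i k)))

-- Least elements of blocks

firstRelated-map : ∀ {M} (E : BRel M) (R : BRel m) (g : Fin m → Fin M) {t u} →
                   (∀ j → E (g j) t ≡ R j u) → ∀ xs rest → Any (λ j → Holds R j u) xs →
                   firstRelated E t (map g xs ++ rest) ≡ g (firstRelated R u xs)
firstRelated-map E R g {u = u} E≗R (j ∷ xs) rest any rewrite E≗R j with R j u in Rju
... | true = refl
... | false with any
...   | here Rju′  = contradiction (trans (sym Rju) Rju′) false≢true
...   | there any′ = firstRelated-map E R g E≗R xs rest any′

firstRelated-skip : ∀ {M} (E : BRel M) (g : Fin m → Fin M) {t} →
                    (∀ j → E (g j) t ≡ false) → ∀ xs rest →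
                    firstRelated E t (map g xs ++ rest) ≡ firstRelated E t rest
firstRelated-skip E g unrelated []       rest = refl
firstRelated-skip E g unrelated (j ∷ xs) rest rewrite unrelated j = firstRelated-skip E g unrelated xs rest

firstRelated-cong : {R R′ : BRel m} {i : Fin m} → (∀ j → R j i ≡ R′ j i) → ∀ xs →
                    firstRelated R i xs ≡ firstRelated R′ i xs
firstRelated-cong             R≗R′ []       = refl
firstRelated-cong {R′ = R′} {i} R≗R′ (j ∷ xs) rewrite R≗R′ j =
  cong (if R′ j i then j else_) (firstRelated-cong R≗R′ xs)

firstRelated-related : (R : BRel m) (i : Fin m) → ∀ xs → Any (λ j → Holds R j i) xs →
                       Holds R (firstRelated R i xs) i
firstRelated-related R i (j ∷ xs) any with R j i in Rji
... | true = Rji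
... | false with any
...   | here Rji′  = contradiction (trans (sym Rji) Rji′) false≢true
...   | there any′ = firstRelated-related R i xs any′

smallest-related : (R : BRel m) {i : Fin m} → Holds R i i → Holds R (smallest R i) i
smallest-related {m} R {i} Rii = firstRelated-related R i (allFin m) (lose (∈-allFin i) Rii)

smallest-column : (R R′ : BRel m) {i i′ : Fin m} → (∀ j → R j i ≡ R′ j i′) → Holds R′ i′ i′ →
                  smallest R i ≡ smallest R′ i′
smallest-column {m} R R′ {i} {i′} R≗R′ R′i′i′ =
  trans (cong (firstRelated R i) (sym (trans (++-identityʳ _) (map-id (allFin m)))))
        (firstRelated-map R R′ id R≗R′ (allFin m) [] (lose (∈-allFin i′) R′i′i′))

smallest-cong : {R R′ : BRel m} → R ≐ᵇ R′ → ∀ i → smallest R i ≡ smallest R′ i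
smallest-cong {m} R≐R′ i = firstRelated-cong (λ j → R≐R′ j i) (allFin m)

smallest-zero : (R : BRel (suc n)) → Holds R zero zero → smallest R zero ≡ zero
smallest-zero R R00 rewrite R00 = refl

smallest-idem : {R : BRel m} → IsEquivalenceᵇ R → ∀ i → smallest R (smallest R i) ≡ smallest R i
smallest-idem {R = R} eq i =
  smallest-column R R (λ j → ≡true-ext (λ p → ∼-trans p si) (λ p → ∼-trans p (∼-sym si))) ∼-refl
  where
  open Equiv eq
  si = smallest-related R {i} ∼-refl

representatives : BRel m → List (Fin m)
representatives {m} R = filter (λ i → smallest R i ≟ i) (allFin m)

representative-unique : {R : BRel m} → IsEquivalenceᵇ R → ∀ {s s′} →
                        smallest R s ≡ s → smallest R s′ ≡ s′ → (∀ j → R s j ≡ R s′ j) → s ≡ s′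
representative-unique {R = R} eq {s} {s′} least least′ Rs≗Rs′ =
  trans (sym least)
    (trans (smallest-column R R (λ j → trans (symmetric j s) (trans (Rs≗Rs′ j) (symmetric s′ j))) ∼-refl)
           least′)
  where open Equiv eq

numBlocks-cong : {R R′ : BRel m} → R ≐ᵇ R′ → numBlocks R ≡ numBlocks R′
numBlocks-cong {m} {R} {R′} R≐R′ =
  cong length (filter-≐ (λ i → smallest R i ≟ i) (λ i → smallest R′ i ≟ i)
                        ((λ {i} p → trans (sym (smallest-cong R≐R′ i)) p) ,
                         (λ {i} p → trans (smallest-cong R≐R′ i) p))
                        (allFin m))

numBlocks-nonzero : {R : BRel (suc n)} → IsEquivalenceᵇ R → (numBlocks R ≡ᵇ 0) ≡ false
numBlocks-nonzero {R = R} eq with smallest R zero ≟ zero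
... | yes _     = refl
... | no ¬least = contradiction (smallest-zero R (Equiv.∼-refl eq)) ¬least

numBlocks≤ : (R : BRel m) → numBlocks R ≤ m
numBlocks≤ {m} R = subst (numBlocks R ≤_) (length-tabulate id)
                         (length-filter (λ i → smallest R i ≟ i) (allFin m))

-- Adjoining a new largest element

-- col i relates old i to the new element, row j relates the new element to old j,
-- and b is the new element's self-relation.
extend : BRel m → (Fin m → Bool) → (Fin m → Bool) → Bool → BRel (suc m)
extend R col row b = snoc (λ i → snoc (R i) (col i)) (snoc row b)

extend-cong : (R : BRel m) {col col′ row row′ : Fin m → Bool} (b : Bool) →
              (∀ i → col i ≡ col′ i) → (∀ i → row i ≡ row′ i) →
              extend R col row b ≐ᵇ extend R col′ row′ b
extend-cong R {col} {col′} {row} {row′} b col≗col′ row≗row′ =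
  snoc-pointwise (λ f g → ∀ j → f j ≡ g j)
    {f = λ i → snoc (R i) (col i)} {g = λ i → snoc (R i) (col′ i)}
    (λ i → snoc-pointwise _≡_ {f = R i} (λ _ → refl) (col≗col′ i))
    (snoc-pointwise _≡_ {f = row} {x = b} row≗row′ refl)

module Extend {m} (R : BRel m) (col row : Fin m → Bool) (b : Bool) where

  private
    E = extend R col row b
    last = fromℕ m
    oldRows = λ i → snoc (R i) (col i)

  old-old : ∀ i j → E (inject₁ i) (inject₁ j) ≡ R i j
  old-old i j = trans (cong (_$ inject₁ j) (snoc-inject₁ oldRows (snoc row b) i)) (snoc-inject₁ (R i) (col i) j)

  old-new : ∀ i → E (inject₁ i) last ≡ col i
  old-new i = trans (cong (_$ last) (snoc-inject₁ oldRows (snoc row b) i)) (snoc-fromℕ (R i) (col i))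

  new-old : ∀ j → E last (inject₁ j) ≡ row j
  new-old j = trans (cong (_$ inject₁ j) (snoc-fromℕ oldRows (snoc row b))) (snoc-inject₁ row b j)

  new-new : E last last ≡ b
  new-new = trans (cong (_$ last) (snoc-fromℕ oldRows (snoc row b))) (snoc-fromℕ row b)

  restrict : IsEquivalenceᵇ E → IsEquivalenceᵇ R
  restrict eq = record
    { refl  = λ {i} → trans (sym (old-old i i)) ∼-refl
    ; sym   = λ {i} {j} p → trans (sym (old-old j i)) (∼-sym (trans (old-old i j) p))
    ; trans = λ {i} {j} {k} p q →
        trans (sym (old-old i k)) (∼-trans (trans (old-old i j) p) (trans (old-old j k) q))
    }
    where open Equiv eq

  new-related-to-itself : IsEquivalenceᵇ E → b ≡ true
  new-related-to-itself eq = trans (sym new-new) ∼-refl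
    where open Equiv eq

  row≗col : IsEquivalenceᵇ E → ∀ i → row i ≡ col i
  row≗col eq i = trans (sym (new-old i)) (trans (symmetric last (inject₁ i)) (old-new i))
    where open Equiv eq

  smallest-old : (∀ i → Holds R i i) → ∀ i → smallest E (inject₁ i) ≡ inject₁ (smallest R i)
  smallest-old reflexive i =
    trans (cong (firstRelated E (inject₁ i)) (allFin-suc-∷ʳ m))
          (firstRelated-map E R inject₁ (λ j → old-old j i) (allFin m) [ last ]
                            (lose (∈-allFin i) (reflexive i)))

  numBlocks-extend : (∀ i → Holds R i i) →
                     numBlocks E ≡ numBlocks R +ℕ (if does (smallest E last ≟ last) then 1 else 0)
  numBlocks-extend reflexive = begin
    length (filter P? (allFin (suc m)))
      ≡⟨ cong (length ∘ filter P?) (allFin-suc-∷ʳ m) ⟩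
    length (filter P? (map inject₁ (allFin m) ++ [ last ]))
      ≡⟨ cong length (filter-++ P? (map inject₁ (allFin m)) [ last ]) ⟩
    length (filter P? (map inject₁ (allFin m)) ++ filter P? [ last ])
      ≡⟨ length-++ (filter P? (map inject₁ (allFin m))) ⟩
    length (filter P? (map inject₁ (allFin m))) +ℕ length (filter P? [ last ])
      ≡⟨ cong₂ _+ℕ_ (length-filter-map P? (λ i → smallest R i ≟ i) inject₁ old-is-least (allFin m))
                   (length-filter-[_] {P? = P?} last) ⟩
    numBlocks R +ℕ (if does (smallest E last ≟ last) then 1 else 0) ∎
    where
    open ≡-Reasoning
    P? = λ i → smallest E i ≟ i
    old-is-least : ∀ i → does (smallest E (inject₁ i) ≟ inject₁ i) ≡ does (smallest R i ≟ i)
    old-is-least i = trans (cong (λ s → does (s ≟ inject₁ i)) (smallest-old reflexive i))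
                           (does-inject₁ (smallest R i) i)

module SymmetricExtend {m} (R : BRel m) (v : Fin m → Bool) where

  open Extend R v v true

  private
    E = extend R v v true
    last = fromℕ m

  extend-isEquivalence : IsEquivalenceᵇ R →
                         (∀ {i j} → v i ≡ true → v j ≡ true → Holds R i j) →
                         (∀ {i j} → v i ≡ true → Holds R i j → v j ≡ true) →
                         IsEquivalenceᵇ E
  extend-isEquivalence eq within closed = record
    { refl  = λ {i} → reflexive i
    ; sym   = λ {i} {j} → symmetric′ i j
    ; trans = λ {i} {j} {k} → transitive i j k
    }
    where
    open Equiv eq
    ↑ : ∀ {i j} → Holds R i j → Holds E (inject₁ i) (inject₁ j)
    ↑ {i} {j} = trans (old-old i j)
    ↓ : ∀ {i j} → Holds E (inject₁ i) (inject₁ j) → Holds R i j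
    ↓ {i} {j} = trans (sym (old-old i j))

    reflexive : ∀ i → Holds E i i
    reflexive i with view i
    ... | ‵fromℕ     = new-new
    ... | ‵inject₁ a = ↑ ∼-refl

    symmetric′ : ∀ i j → Holds E i j → Holds E j i
    symmetric′ i j p with view i | view j
    ... | ‵inject₁ a | ‵inject₁ c = ↑ (∼-sym (↓ p))
    ... | ‵inject₁ a | ‵fromℕ     = trans (new-old a) (trans (sym (old-new a)) p)
    ... | ‵fromℕ     | ‵inject₁ c = trans (old-new c) (trans (sym (new-old c)) p)
    ... | ‵fromℕ     | ‵fromℕ     = p

    transitive : ∀ i j k → Holds E i j → Holds E j k → Holds E i k
    transitive i j k p q with view i | view j | view k
    ... | ‵inject₁ a | ‵inject₁ c | ‵inject₁ d = ↑ (∼-trans (↓ p) (↓ q))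
    ... | ‵inject₁ a | ‵inject₁ c | ‵fromℕ     =
      trans (old-new a) (closed (trans (sym (old-new c)) q) (∼-sym (↓ p)))
    ... | ‵inject₁ a | ‵fromℕ     | ‵inject₁ d =
      ↑ (within (trans (sym (old-new a)) p) (trans (sym (new-old d)) q))
    ... | ‵inject₁ a | ‵fromℕ     | ‵fromℕ     = p
    ... | ‵fromℕ     | ‵inject₁ c | ‵inject₁ d =
      trans (new-old d) (closed (trans (sym (new-old c)) p) (↓ q))
    ... | ‵fromℕ     | ‵inject₁ c | ‵fromℕ     = new-new
    ... | ‵fromℕ     | ‵fromℕ     | _          = q

  column-cases : IsEquivalenceᵇ E →
                 (∀ i → v i ≡ false) ⊎ Σ[ s ∈ Fin m ] smallest R s ≡ s × (∀ j → v j ≡ R s j)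
  column-cases eqE with any? (λ i → v i Bool.≟ true)
  ... | no none      = inj₁ (λ i → ¬-not (λ vi → none (i , vi)))
  ... | yes (i , vi) = inj₂ (smallest R i , smallest-idem eq i , λ j → ≡true-ext (to j) (from j))
    where
    eq = restrict eqE
    open Equiv eq
    module E = Equiv eqE
    s = smallest R i
    si : Holds R s i
    si = smallest-related R ∼-refl
    new~ : ∀ {j} → v j ≡ true → Holds E (inject₁ j) last
    new~ {j} = trans (old-new j)
    to : ∀ j → v j ≡ true → Holds R s j
    to j vj = ∼-trans si (trans (sym (old-old i j))
                (E.∼-trans (new~ vi) (E.∼-sym (new~ vj))))
    from : ∀ j → Holds R s j → v j ≡ true
    from j sj = trans (sym (old-new j))
                  (E.∼-trans {inject₁ j} (trans (old-old j i) (∼-trans (∼-sym sj) si)) (new~ vi))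

  smallest-new-block : (∀ i → v i ≡ false) → smallest E last ≡ last
  smallest-new-block v≗false =
    trans (cong (firstRelated E last) (allFin-suc-∷ʳ m))
      (trans (firstRelated-skip E inject₁ (λ j → trans (old-new j) (v≗false j)) (allFin m) [ last ])
             (if-eta (E last last)))

  smallest-join : IsEquivalenceᵇ R → ∀ {s} → smallest R s ≡ s → (∀ j → v j ≡ R s j) →
                  smallest E last ≡ inject₁ s
  smallest-join eq {s} least v≗Rs =
    trans (cong (firstRelated E last) (allFin-suc-∷ʳ m))
      (trans (firstRelated-map E R inject₁ (λ j → trans (old-new j) (trans (v≗Rs j) (symmetric s j)))
                               (allFin m) [ last ] (lose (∈-allFin s) ∼-refl))
             (cong inject₁ least))
    where open Equiv eq

addSingleton : BRel m → BRel (suc m)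
addSingleton R = extend R (λ _ → false) (λ _ → false) true

addToBlock : BRel m → Fin m → BRel (suc m)
addToBlock R s = extend R (R s) (R s) true

module _ {m} {R : BRel m} (eq : IsEquivalenceᵇ R) where
  open Equiv eq

  addSingleton-isEquivalence : IsEquivalenceᵇ (addSingleton R)
  addSingleton-isEquivalence = SymmetricExtend.extend-isEquivalence R _ eq (λ ()) (λ ())

  addToBlock-isEquivalence : ∀ s → IsEquivalenceᵇ (addToBlock R s)
  addToBlock-isEquivalence s =
    SymmetricExtend.extend-isEquivalence R (R s) eq (λ si sj → ∼-trans (∼-sym si) sj) ∼-trans

  smallest-addSingleton : smallest (addSingleton R) (fromℕ m) ≡ fromℕ m
  smallest-addSingleton = SymmetricExtend.smallest-new-block R _ (λ _ → refl)

  smallest-addToBlock : ∀ {s} → smallest R s ≡ s → smallest (addToBlock R s) (fromℕ m) ≡ inject₁ s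
  smallest-addToBlock least = SymmetricExtend.smallest-join R _ eq least (λ _ → refl)

  numBlocks-addSingleton : numBlocks (addSingleton R) ≡ suc (numBlocks R)
  numBlocks-addSingleton = begin
    numBlocks (addSingleton R)
      ≡⟨ Extend.numBlocks-extend R _ _ true (λ _ → ∼-refl) ⟩
    numBlocks R +ℕ (if does (smallest (addSingleton R) (fromℕ m) ≟ fromℕ m) then 1 else 0)
      ≡⟨ cong (λ s → numBlocks R +ℕ (if does (s ≟ fromℕ m) then 1 else 0)) smallest-addSingleton ⟩
    numBlocks R +ℕ (if does (fromℕ m ≟ fromℕ m) then 1 else 0)
      ≡⟨ cong (λ t → numBlocks R +ℕ (if t then 1 else 0)) (dec-true (fromℕ m ≟ fromℕ m) refl) ⟩
    numBlocks R +ℕ 1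
      ≡⟨ ℕ.+-comm (numBlocks R) 1 ⟩
    suc (numBlocks R) ∎
    where open ≡-Reasoning

  numBlocks-addToBlock : ∀ {s} → smallest R s ≡ s → numBlocks (addToBlock R s) ≡ numBlocks R
  numBlocks-addToBlock {s} least = begin
    numBlocks (addToBlock R s)
      ≡⟨ Extend.numBlocks-extend R _ _ true (λ _ → ∼-refl) ⟩
    numBlocks R +ℕ (if does (smallest (addToBlock R s) (fromℕ m) ≟ fromℕ m) then 1 else 0)
      ≡⟨ cong (λ t → numBlocks R +ℕ (if does (t ≟ fromℕ m) then 1 else 0)) (smallest-addToBlock least) ⟩
    numBlocks R +ℕ (if does (inject₁ s ≟ fromℕ m) then 1 else 0)
      ≡⟨ cong (λ t → numBlocks R +ℕ (if t then 1 else 0)) (does-inject₁-fromℕ s) ⟩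
    numBlocks R +ℕ 0
      ≡⟨ ℕ.+-identityʳ (numBlocks R) ⟩
    numBlocks R ∎
    where open ≡-Reasoning

-- Weighted sums in a commutative semiring

module Sums {c ℓ : Level} (S : CommutativeSemiring c ℓ) where

  open CommutativeSemiring S hiding (zero)
    renaming (refl to ≈-refl; sym to ≈-sym; trans to ≈-trans; reflexive to ≡⇒≈)
  open import Relation.Binary.Reasoning.Setoid setoid

  ∑ : List A → (A → Carrier) → Carrier
  ∑ xs f = sumL S (map f xs)

  ∏ : List A → (A → Carrier) → Carrier
  ∏ xs f = prodL S (map f xs)

  ∑-cong : ∀ (xs : List A) {f g} → (∀ x → f x ≈ g x) → ∑ xs f ≈ ∑ xs g
  ∑-cong []       f≈g = ≈-refl
  ∑-cong (x ∷ xs) f≈g = +-cong (f≈g x) (∑-cong xs f≈g)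

  ∑-cong-∈ : ∀ (xs : List A) {f g} → (∀ {x} → x ∈ xs → f x ≈ g x) → ∑ xs f ≈ ∑ xs g
  ∑-cong-∈ []       f≈g = ≈-refl
  ∑-cong-∈ (x ∷ xs) f≈g = +-cong (f≈g (here refl)) (∑-cong-∈ xs (f≈g ∘ there))

  ∑-zero : ∀ (xs : List A) {f} → (∀ x → f x ≈ 0#) → ∑ xs f ≈ 0#
  ∑-zero []       f≈0 = ≈-refl
  ∑-zero (x ∷ xs) f≈0 = ≈-trans (+-cong (f≈0 x) (∑-zero xs f≈0)) (+-identityˡ 0#)

  ∑-+ : ∀ (xs : List A) f g → ∑ xs (λ x → f x + g x) ≈ ∑ xs f + ∑ xs g
  ∑-+ []       f g = ≈-sym (+-identityˡ 0#)
  ∑-+ (x ∷ xs) f g = begin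
    (f x + g x) + ∑ xs (λ x → f x + g x) ≈⟨ +-cong ≈-refl (∑-+ xs f g) ⟩
    (f x + g x) + (∑ xs f + ∑ xs g)      ≈⟨ +-assoc _ _ _ ⟩
    f x + (g x + (∑ xs f + ∑ xs g))      ≈⟨ +-cong ≈-refl (x+[y+z]≈y+[x+z] _ _ _) ⟩
    f x + (∑ xs f + (g x + ∑ xs g))      ≈⟨ ≈-sym (+-assoc _ _ _) ⟩
    (f x + ∑ xs f) + (g x + ∑ xs g)      ∎
    where
    x+[y+z]≈y+[x+z] : ∀ a b c → a + (b + c) ≈ b + (a + c)
    x+[y+z]≈y+[x+z] a b c =
      ≈-trans (≈-sym (+-assoc a b c)) (≈-trans (+-cong (+-comm a b) ≈-refl) (+-assoc b a c))

  ∑-*ˡ : ∀ (xs : List A) a f → ∑ xs (λ x → a * f x) ≈ a * ∑ xs f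
  ∑-*ˡ []       a f = ≈-sym (zeroʳ a)
  ∑-*ˡ (x ∷ xs) a f = ≈-trans (+-cong ≈-refl (∑-*ˡ xs a f)) (≈-sym (distribˡ a _ _))

  ∑-++ : ∀ (xs ys : List A) f → ∑ (xs ++ ys) f ≈ ∑ xs f + ∑ ys f
  ∑-++ []       ys f = ≈-sym (+-identityˡ _)
  ∑-++ (x ∷ xs) ys f = ≈-trans (+-cong ≈-refl (∑-++ xs ys f)) (≈-sym (+-assoc _ _ _))

  ∑-map : {B : Set} (xs : List A) (g : A → B) (f : B → Carrier) → ∑ (map g xs) f ≡ ∑ xs (f ∘ g)
  ∑-map []       g f = refl
  ∑-map (x ∷ xs) g f = cong (f (g x) +_) (∑-map xs g f)

  ∑-concatMap : {B : Set} (xs : List A) (g : A → List B) (f : B → Carrier) →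
                ∑ (concatMap g xs) f ≈ ∑ xs (λ x → ∑ (g x) f)
  ∑-concatMap []       g f = ≈-refl
  ∑-concatMap (x ∷ xs) g f = ≈-trans (∑-++ (g x) (concatMap g xs) f) (+-cong ≈-refl (∑-concatMap xs g f))

  ∑-comm : {B : Set} (xs : List A) (ys : List B) (f : A → B → Carrier) →
           ∑ xs (λ x → ∑ ys (f x)) ≈ ∑ ys (λ y → ∑ xs (λ x → f x y))
  ∑-comm []       ys f = ≈-sym (∑-zero ys (λ _ → ≈-refl))
  ∑-comm (x ∷ xs) ys f = ≈-trans (+-cong ≈-refl (∑-comm xs ys f)) (≈-sym (∑-+ ys (f x) _))

  ∑-filter : (p : A → Bool) (xs : List A) (f : A → Carrier) →
             ∑ (filter (λ x → p x Bool.≟ true) xs) f ≈ ∑ xs (λ x → if p x then f x else 0#)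
  ∑-filter p []       f = ≈-refl
  ∑-filter p (x ∷ xs) f with p x
  ... | true  = +-cong ≈-refl (∑-filter p xs f)
  ... | false = ≈-trans (∑-filter p xs f) (≈-sym (+-identityˡ _))

  ∏-cong : ∀ (xs : List A) {f g} → (∀ x → f x ≈ g x) → ∏ xs f ≈ ∏ xs g
  ∏-cong []       f≈g = ≈-refl
  ∏-cong (x ∷ xs) f≈g = *-cong (f≈g x) (∏-cong xs f≈g)

  ∏-++ : ∀ (xs ys : List A) f → ∏ (xs ++ ys) f ≈ ∏ xs f * ∏ ys f
  ∏-++ []       ys f = ≈-sym (*-identityˡ _)
  ∏-++ (x ∷ xs) ys f = ≈-trans (*-cong ≈-refl (∏-++ xs ys f)) (≈-sym (*-assoc _ _ _))

  ∏-map : {B : Set} (xs : List A) (g : A → B) (f : B → Carrier) → ∏ (map g xs) f ≡ ∏ xs (f ∘ g)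
  ∏-map []       g f = refl
  ∏-map (x ∷ xs) g f = cong (f (g x) *_) (∏-map xs g f)

  module FunctionSums {A : Set} (_~_ : A → A → Set) (~-refl : ∀ {a} → a ~ a) where

    -- allFuns builds its functions with pattern lambdas, which are not definitionally equal
    -- to the ones they are compared with, so summands must respect pointwise equality.
    Respects : ∀ n → ((Fin n → A) → Carrier) → Set _
    Respects n h = ∀ {f g} → (∀ i → f i ~ g i) → h f ≈ h g

    ∷-respects : ∀ {n} x {h} → Respects (suc n) h → Respects n (λ f → h (x Vector.∷ f))
    ∷-respects x resp f~g = resp λ { zero → ~-refl ; (suc i) → f~g i }

    ∑-allFuns-∷ : ∀ n xs h → Respects (suc n) h →
                  ∑ (allFuns (suc n) xs) h ≈ ∑ xs (λ x → ∑ (allFuns n xs) (λ f → h (x Vector.∷ f)))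
    ∑-allFuns-∷ n xs h resp =
      ≈-trans (∑-concatMap xs _ h) (∑-cong xs λ x →
        ≈-trans (≡⇒≈ (∑-map (allFuns n xs) _ h)) (∑-cong (allFuns n xs) λ f →
          resp λ { zero → ~-refl ; (suc i) → ~-refl }))

    ∑-allFuns-snoc : ∀ n xs h → Respects (suc n) h →
                     ∑ (allFuns (suc n) xs) h ≈ ∑ (allFuns n xs) (λ f → ∑ xs (λ x → h (snoc f x)))
    ∑-allFuns-snoc zero xs h resp = begin
      ∑ (allFuns 1 xs) h                      ≈⟨ ∑-allFuns-∷ zero xs h resp ⟩
      ∑ xs (λ x → h (x Vector.∷ λ ()) + 0#)
        ≈⟨ ∑-cong xs (λ x → ≈-trans (+-identityʳ _) (resp λ { zero → ~-refl })) ⟩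
      ∑ xs (λ x → h (snoc (λ ()) x))          ≈⟨ ≈-sym (+-identityʳ _) ⟩
      ∑ (allFuns zero xs) (λ f → ∑ xs (λ x → h (snoc f x))) ∎
    ∑-allFuns-snoc (suc n) xs h resp = begin
      ∑ (allFuns (suc (suc n)) xs) h
        ≈⟨ ∑-allFuns-∷ (suc n) xs h resp ⟩
      ∑ xs (λ x → ∑ (allFuns (suc n) xs) (λ f → h (x Vector.∷ f)))
        ≈⟨ ∑-cong xs (λ x → ∑-allFuns-snoc n xs _ (∷-respects x resp)) ⟩
      ∑ xs (λ x → ∑ (allFuns n xs) (λ f → ∑ xs (λ y → h (x Vector.∷ snoc f y))))
        ≈⟨ ∑-cong xs (λ x → ∑-cong (allFuns n xs) λ f → ∑-cong xs λ y →
             resp λ { zero → ~-refl ; (suc i) → ~-refl }) ⟩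
      ∑ xs (λ x → ∑ (allFuns n xs) (λ f → ∑ xs (λ y → h (snoc (x Vector.∷ f) y))))
        ≈⟨ ≈-sym (∑-allFuns-∷ n xs _ snoc-respects) ⟩
      ∑ (allFuns (suc n) xs) (λ f → ∑ xs (λ x → h (snoc f x))) ∎
      where
      snoc-respects : Respects (suc n) (λ f → ∑ xs (λ x → h (snoc f x)))
      snoc-respects f~g = ∑-cong xs λ x → resp (snoc-pointwise _~_ f~g ~-refl)

  module _ {A U V : Set} (_~_ : A → A → Set) (~-refl : ∀ {a} → a ~ a) where
    open FunctionSums _~_ ~-refl
    private
      module U = FunctionSums {U} _≡_ refl
      module V = FunctionSums {V} _≡_ refl

    ∑-allFuns-zip : (ys : List A) (us : List U) (vs : List V) (pair : U → V → A) →
                    (∀ k → (∀ {a a′} → a ~ a′ → k a ≈ k a′) →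
                       ∑ ys k ≈ ∑ us (λ u → ∑ vs (λ v → k (pair u v)))) →
                    ∀ n h → Respects n h →
                    ∑ (allFuns n ys) h ≈ ∑ (allFuns n us) (λ P → ∑ (allFuns n vs) (λ Q → h (zipWith pair P Q)))
    ∑-allFuns-zip ys us vs pair split zero h resp =
      +-cong (≈-trans (resp λ ()) (≈-sym (+-identityʳ _))) ≈-refl
    ∑-allFuns-zip ys us vs pair split (suc n) h resp = begin
      ∑ (allFuns (suc n) ys) h
        ≈⟨ ∑-allFuns-∷ n ys h resp ⟩
      ∑ ys (λ a → ∑ (allFuns n ys) (λ f → h (a Vector.∷ f)))
        ≈⟨ ∑-cong ys (λ a → ∑-allFuns-zip ys us vs pair split n _ (∷-respects a resp)) ⟩
      ∑ ys K
        ≈⟨ split K K-respects ⟩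
      ∑ us (λ u → ∑ vs (λ v → K (pair u v)))
        ≈⟨ ∑-cong us (λ u → ∑-comm vs (allFuns n us) _) ⟩
      ∑ us (λ u → ∑ (allFuns n us) (λ P → ∑ vs (λ v → ∑ (allFuns n vs) (λ Q →
        h (pair u v Vector.∷ zipWith pair P Q)))))
        ≈⟨ ∑-cong us (λ u → ∑-cong (allFuns n us) λ P → ∑-cong vs λ v → ∑-cong (allFuns n vs) λ Q →
             resp λ { zero → ~-refl ; (suc i) → ~-refl }) ⟩
      ∑ us (λ u → ∑ (allFuns n us) (λ P → ∑ vs (λ v → ∑ (allFuns n vs) (λ Q →
        h (zipWith pair (u Vector.∷ P) (v Vector.∷ Q))))))
        ≈⟨ ∑-cong us (λ u → ∑-cong (allFuns n us) λ P →
             ≈-sym (V.∑-allFuns-∷ n vs _ λ Q≗Q′ → resp (zip-respects (λ _ → refl) Q≗Q′))) ⟩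
      ∑ us (λ u → ∑ (allFuns n us) (λ P → ∑ (allFuns (suc n) vs) (λ Q → h (zipWith pair (u Vector.∷ P) Q))))
        ≈⟨ ≈-sym (U.∑-allFuns-∷ n us _ λ P≗P′ → ∑-cong (allFuns (suc n) vs) λ Q →
             resp (zip-respects P≗P′ (λ _ → refl))) ⟩
      ∑ (allFuns (suc n) us) (λ P → ∑ (allFuns (suc n) vs) (λ Q → h (zipWith pair P Q))) ∎
      where
      K : A → Carrier
      K a = ∑ (allFuns n us) (λ P → ∑ (allFuns n vs) (λ Q → h (a Vector.∷ zipWith pair P Q)))
      K-respects : ∀ {a a′} → a ~ a′ → K a ≈ K a′
      K-respects a~a′ = ∑-cong (allFuns n us) λ P → ∑-cong (allFuns n vs) λ Q →
        resp λ { zero → a~a′ ; (suc i) → ~-refl }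
      zip-respects : ∀ {n} {P P′ : Fin n → U} {Q Q′ : Fin n → V} → P ≗ P′ → Q ≗ Q′ →
                     ∀ i → zipWith pair P Q i ~ zipWith pair P′ Q′ i
      zip-respects P≗P′ Q≗Q′ i rewrite P≗P′ i | Q≗Q′ i = ~-refl

  bools : List Bool
  bools = true ∷ false ∷ []

  ∑-allBRels-suc : ∀ m (g : BRel (suc m) → Carrier) → (∀ {R R′} → R ≐ᵇ R′ → g R ≈ g R′) →
    ∑ (allBRels (suc m)) g ≈
    ∑ (allBRels m) (λ R → ∑ (allFuns m bools) (λ col → ∑ (allFuns m bools) (λ row →
      ∑ bools (λ b → g (extend R col row b)))))
  ∑-allBRels-suc m g g-cong = begin
    ∑ (allBRels (suc m)) g
      ≈⟨ Rows.∑-allFuns-snoc m rows g g-cong ⟩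
    ∑ (allFuns m rows) h
      ≈⟨ ∑-allFuns-zip _≗_ (λ _ → refl) rows (allFuns m bools) bools snoc
           (λ k → Bools.∑-allFuns-snoc m bools k) m h h-cong ⟩
    ∑ (allBRels m) (λ R → ∑ (allFuns m bools) (λ col → h (zipWith snoc R col)))
      ≈⟨ ∑-cong (allBRels m) (λ R → ∑-cong (allFuns m bools) λ col →
           Bools.∑-allFuns-snoc m bools _ λ l≗l′ → g-cong (snoc-pointwise _≗_ (λ _ _ → refl) l≗l′)) ⟩
    ∑ (allBRels m) (λ R → ∑ (allFuns m bools) (λ col → ∑ (allFuns m bools) (λ row →
      ∑ bools (λ b → g (extend R col row b))))) ∎
    where
    module Rows = FunctionSums {Fin (suc m) → Bool} _≗_ (λ _ → refl)
    module Bools = FunctionSums {Bool} _≡_ refl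
    rows = allFuns (suc m) bools
    h : (Fin m → Fin (suc m) → Bool) → Carrier
    h rs = ∑ rows (λ l → g (snoc rs l))
    h-cong : Rows.Respects m h
    h-cong rs≗rs′ = ∑-cong rows λ l → g-cong (snoc-pointwise _≗_ rs≗rs′ (λ _ → refl))

  if-cong≈ : ∀ t {a b c d} → a ≈ b → c ≈ d → (if t then a else c) ≈ (if t then b else d)
  if-cong≈ true  a≈b _   = a≈b
  if-cong≈ false _   c≈d = c≈d

  ∑-if-none : (xs : List A) (p : A → Bool) (f : A → Carrier) → (∀ {x} → x ∈ xs → p x ≡ false) →
              ∑ xs (λ x → if p x then f x else 0#) ≈ 0#
  ∑-if-none []       p f none = ≈-refl
  ∑-if-none (x ∷ xs) p f none rewrite none (here refl) =
    ≈-trans (+-identityˡ _) (∑-if-none xs p f (none ∘ there))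

  ∑-if-unique : (xs : List A) (p : A → Bool) (f : A → Carrier) {a : A} → Unique xs → a ∈ xs → p a ≡ true →
                (∀ {x} → x ∈ xs → p x ≡ true → x ≡ a) → ∑ xs (λ x → if p x then f x else 0#) ≈ f a
  ∑-if-unique (x ∷ xs) p f (x∉xs ∷ unique) (here refl) pa only rewrite pa =
    ≈-trans (+-cong ≈-refl (∑-if-none xs p f λ x∈xs →
               ¬-not λ px → All.lookup x∉xs x∈xs (sym (only (there x∈xs) px))))
            (+-identityʳ _)
  ∑-if-unique (x ∷ xs) p f (x∉xs ∷ unique) (there a∈xs) pa only with p x in px
  ... | true  = contradiction (only (here refl) px) (All.lookup x∉xs a∈xs)
  ... | false = ≈-trans (+-identityˡ _) (∑-if-unique xs p f unique a∈xs pa (only ∘ there))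

  ∑-if-≗-allFuns : ∀ m (v : Fin m → Bool) X → ∑ (allFuns m bools) (λ f → if does (f ≗? v) then X else 0#) ≈ X
  ∑-if-≗-allFuns zero    v X = +-identityʳ X
  ∑-if-≗-allFuns (suc m) v X = begin
    ∑ (allFuns (suc m) bools) (λ f → if does (f ≗? v) then X else 0#)
      ≈⟨ Bools.∑-allFuns-∷ m bools _ (λ f≗g → ≡⇒≈ (cong (if_then X else 0#) (does-≗?-cong f≗g))) ⟩
    ∑ bools (λ x → ∑ (allFuns m bools) (λ f → if does ((x Vector.∷ f) ≗? v) then X else 0#))
      ≈⟨ ∑-cong bools (λ x → ∑-cong (allFuns m bools) λ f →
           ≡⇒≈ (trans (cong (if_then X else 0#) (does-≗?-∷ x f))
                      (if-∧ (does (x Bool.≟ v zero))))) ⟩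
    ∑ bools (λ x → ∑ (allFuns m bools) (λ f →
      if does (x Bool.≟ v zero) then (if does (f ≗? (v ∘ suc)) then X else 0#) else 0#))
      ≈⟨ ∑-cong bools (λ x → head-sum x) ⟩
    ∑ bools (λ x → if does (x Bool.≟ v zero) then X else 0#)
      ≈⟨ head-count (v zero) ⟩
    X ∎
    where
    module Bools = FunctionSums {Bool} _≡_ refl
    does-≗?-cong : {f g : Fin (suc m) → Bool} → f ≗ g → does (f ≗? v) ≡ does (g ≗? v)
    does-≗?-cong {f} {g} f≗g =
      does-⇔ (mk⇔ (λ f≗v i → trans (sym (f≗g i)) (f≗v i)) (λ g≗v i → trans (f≗g i) (g≗v i)))
             (f ≗? v) (g ≗? v)
    does-≗?-∷ : ∀ x f → does ((x Vector.∷ f) ≗? v) ≡ does (x Bool.≟ v zero) ∧ does (f ≗? (v ∘ suc))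
    does-≗?-∷ x f = does-⇔ (mk⇔ (λ x∷f≗v → x∷f≗v zero , x∷f≗v ∘ suc)
                                 λ { (x≡ , f≗) → λ { zero → x≡ ; (suc i) → f≗ i } })
                           ((x Vector.∷ f) ≗? v) ((x Bool.≟ v zero) ×-dec (f ≗? (v ∘ suc)))
    head-sum : ∀ x → ∑ (allFuns m bools) (λ f →
                 if does (x Bool.≟ v zero) then (if does (f ≗? (v ∘ suc)) then X else 0#) else 0#)
               ≈ (if does (x Bool.≟ v zero) then X else 0#)
    head-sum x with does (x Bool.≟ v zero)
    ... | true  = ∑-if-≗-allFuns m (v ∘ suc) X
    ... | false = ∑-zero (allFuns m bools) (λ _ → ≈-refl)
    head-count : ∀ t → ∑ bools (λ x → if does (x Bool.≟ t) then X else 0#) ≈ X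
    head-count true  = ≈-trans (+-cong ≈-refl (+-identityʳ 0#)) (+-identityʳ X)
    head-count false = ≈-trans (+-identityˡ _) (+-identityʳ X)

  module EquivalenceSums {m} (g : BRel (suc m) → Carrier)
                         (g-cong : ∀ {E E′} → E ≐ᵇ E′ → g E ≈ g E′)
                         (g-vanishes : ∀ {E} → ¬ IsEquivalenceᵇ E → g E ≈ 0#) where

    private
      cols = allFuns m bools
      none : Fin m → Bool
      none _ = false

    ∑-rows-bits : ∀ R col →
                  ∑ cols (λ row → ∑ bools (λ b → g (extend R col row b))) ≈ g (extend R col col true)
    ∑-rows-bits R col = ≈-trans (∑-cong cols only-symmetric) (∑-if-≗-allFuns m col _)
      where
      only-symmetric : ∀ row → ∑ bools (λ b → g (extend R col row b))
                               ≈ (if does (row ≗? col) then g (extend R col col true) else 0#)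
      only-symmetric row with row ≗? col
      ... | yes row≗col =
        ≈-trans (+-cong (g-cong (extend-cong R true (λ _ → refl) row≗col)) (+-cong not-reflexive ≈-refl))
          (≈-trans (+-cong ≈-refl (+-identityʳ 0#))
            (≈-trans (+-identityʳ _) (≡⇒≈ (cong (if_then _ else 0#) (sym (dec-true (row ≗? col) row≗col))))))
        where not-reflexive = g-vanishes (false≢true ∘ Extend.new-related-to-itself R col row false)
      ... | no ¬row≗col =
        ≈-trans (+-cong (g-vanishes (¬row≗col ∘ Extend.row≗col R col row true)) (+-cong not-reflexive ≈-refl))
          (≈-trans (+-identityˡ _)
            (≈-trans (+-identityˡ 0#) (≡⇒≈ (cong (if_then _ else 0#) (sym (dec-false (row ≗? col) ¬row≗col))))))
        where not-reflexive = g-vanishes (false≢true ∘ Extend.new-related-to-itself R col row false)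

    module _ {R : BRel m} (eq : IsEquivalenceᵇ R) where
      open Equiv eq

      private
        least? = λ i → smallest R i ≟ i
        reps = representatives R
        blocks : (Fin m → Bool) → Carrier
        blocks col = ∑ reps (λ s → if does (col ≗? R s) then g (addToBlock R s) else 0#)

      column-split : ∀ col → g (extend R col col true)
                             ≈ (if does (col ≗? none) then g (addSingleton R) else 0#) + blocks col
      column-split col with isEquivᵇ (extend R col col true) Bool.≟ true
      ... | no ¬isEquiv =
        ≈-trans (g-vanishes (¬isEquiv ∘ IsEquivalence⇒isEquivᵇ _))
                (≈-sym (≈-trans (+-cong not-singleton no-block) (+-identityˡ 0#)))
        where
        ¬equiv : ∀ {v} → col ≗ v → IsEquivalenceᵇ (extend R v v true) → ⊥
        ¬equiv col≗v eqE = ¬isEquiv (trans (isEquivᵇ-cong (extend-cong R true col≗v col≗v))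
                                           (IsEquivalence⇒isEquivᵇ _ eqE))
        not-singleton : (if does (col ≗? none) then g (addSingleton R) else 0#) ≈ 0#
        not-singleton = ≡⇒≈ (cong (if_then _ else 0#)
          (dec-false (col ≗? none) λ col≗none → ¬equiv col≗none (addSingleton-isEquivalence eq)))
        no-block : blocks col ≈ 0#
        no-block = ∑-if-none reps _ _ λ {s} _ →
          dec-false (col ≗? R s) λ col≗Rs → ¬equiv col≗Rs (addToBlock-isEquivalence eq s)
      ... | yes isEquiv with SymmetricExtend.column-cases R col (isEquivᵇ⇒IsEquivalence _ isEquiv)
      ...   | inj₁ col≗none =
        ≈-trans (g-cong (extend-cong R true col≗none col≗none))
                (≈-sym (≈-trans (+-cong singleton no-block) (+-identityʳ _)))
        where
        singleton : (if does (col ≗? none) then g (addSingleton R) else 0#) ≈ g (addSingleton R)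
        singleton = ≡⇒≈ (cong (if_then _ else 0#) (dec-true (col ≗? none) col≗none))
        no-block : blocks col ≈ 0#
        no-block = ∑-if-none reps _ _ λ {s} _ →
          dec-false (col ≗? R s) λ col≗Rs → false≢true (trans (sym (col≗none s)) (trans (col≗Rs s) ∼-refl))
      ...   | inj₂ (s₀ , least , col≗Rs₀) =
        ≈-trans (g-cong (extend-cong R true col≗Rs₀ col≗Rs₀))
                (≈-sym (≈-trans (+-cong not-singleton one-block) (+-identityˡ _)))
        where
        not-singleton : (if does (col ≗? none) then g (addSingleton R) else 0#) ≈ 0#
        not-singleton = ≡⇒≈ (cong (if_then _ else 0#) (dec-false (col ≗? none) λ col≗none →
          false≢true (trans (sym (col≗none s₀)) (trans (col≗Rs₀ s₀) ∼-refl))))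
        one-block : blocks col ≈ g (addToBlock R s₀)
        one-block =
          ∑-if-unique reps _ _ (Unique.filter⁺ least? (Unique.allFin⁺ m))
            (∈-filter⁺ least? (∈-allFin s₀) least) (dec-true (col ≗? R s₀) col≗Rs₀)
            λ {s} s∈reps col≗?Rs →
              representative-unique eq (proj₂ (∈-filter⁻ least? {xs = allFin m} s∈reps)) least
              λ j → trans (sym (does-true⇒ (col ≗? R s) col≗?Rs j)) (col≗Rs₀ j)

      ∑-columns : ∑ cols (λ col → g (extend R col col true)) ≈ g (addSingleton R) + ∑ reps (g ∘ addToBlock R)
      ∑-columns = begin
        ∑ cols (λ col → g (extend R col col true))
          ≈⟨ ∑-cong cols column-split ⟩
        ∑ cols (λ col → (if does (col ≗? none) then g (addSingleton R) else 0#) + blocks col)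
          ≈⟨ ∑-+ cols _ blocks ⟩
        ∑ cols (λ col → if does (col ≗? none) then g (addSingleton R) else 0#) + ∑ cols blocks
          ≈⟨ +-cong (∑-if-≗-allFuns m none _) (∑-comm cols reps _) ⟩
        g (addSingleton R) + ∑ reps (λ s → ∑ cols (λ col → if does (col ≗? R s) then g (addToBlock R s) else 0#))
          ≈⟨ +-cong ≈-refl (∑-cong reps λ s → ∑-if-≗-allFuns m (R s) _) ⟩
        g (addSingleton R) + ∑ reps (g ∘ addToBlock R) ∎

    ∑-equivalences-suc :
      ∑ (allBRels (suc m)) g ≈
      ∑ (allBRels m) (λ R → if isEquivᵇ R then g (addSingleton R) + ∑ (representatives R) (g ∘ addToBlock R) else 0#)
    ∑-equivalences-suc =
      ≈-trans (∑-allBRels-suc m g g-cong) (∑-cong (allBRels m) λ R →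
        ≈-trans (∑-cong cols (∑-rows-bits R)) (by-cases R))
      where
      by-cases : ∀ R → ∑ cols (λ col → g (extend R col col true))
                       ≈ (if isEquivᵇ R then g (addSingleton R) + ∑ (representatives R) (g ∘ addToBlock R) else 0#)
      by-cases R with isEquivᵇ R in isEquiv
      ... | true  = ∑-columns (isEquivᵇ⇒IsEquivalence R isEquiv)
      ... | false = ∑-zero cols λ col → g-vanishes λ eqE →
        false≢true (trans (sym isEquiv) (IsEquivalence⇒isEquivᵇ R (Extend.restrict R col col true eqE)))

  ∑-const : (xs : List A) {f : A → Carrier} {a : Carrier} → All (λ x → f x ≡ a) xs →
            ∑ xs f ≈ _•_ S (length xs) a
  ∑-const []       []           = ≈-refl
  ∑-const (x ∷ xs) (fx≡a ∷ all) = +-cong (≡⇒≈ fx≡a) (∑-const xs all)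

  •-zeroʳ : ∀ k → _•_ S k 0# ≈ 0#
  •-zeroʳ zero    = ≈-refl
  •-zeroʳ (suc k) = ≈-trans (+-cong ≈-refl (•-zeroʳ k)) (+-identityˡ 0#)

  module Partitions (x y z : Carrier) where

    weightOf : Fin m → Fin m → Carrier
    weightOf zero    i = x
    weightOf (suc s) i = if isYes (suc s ≟ i) then y else z

    weight≡weightOf : (R : BRel m) (i : Fin m) → weight S R x y z i ≡ weightOf (smallest R i) i
    weight≡weightOf R i with smallest R i
    ... | zero  = refl
    ... | suc s = refl

    weightProduct : BRel (suc n) → Carrier
    weightProduct {n} R = ∏ (allFin n) (λ j → weight S R x y z (suc j))

    summand : ℕ → BRel (suc n) → Carrier
    summand b R = if isEquivᵇ R ∧ (numBlocks R ≡ᵇ b) then weightProduct R else 0#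

    partitionTotal : ℕ → ℕ → Carrier
    partitionTotal n b = ∑ (allBRels (suc n)) (summand b)

    partitionSum≈partitionTotal : ∀ n b → partitionSum S n b x y z ≈ partitionTotal n b
    partitionSum≈partitionTotal n b =
      ∑-filter (λ R → isEquivᵇ R ∧ (numBlocks R ≡ᵇ b)) (allBRels (suc n)) weightProduct

    summand-cong : ∀ b {R R′ : BRel (suc n)} → R ≐ᵇ R′ → summand b R ≈ summand b R′
    summand-cong {n} b {R} {R′} R≐R′ rewrite isEquivᵇ-cong R≐R′ | numBlocks-cong R≐R′ =
      if-cong≈ (isEquivᵇ R′ ∧ (numBlocks R′ ≡ᵇ b)) (∏-cong (allFin n) same-weight) ≈-refl
      where
      same-weight : ∀ j → weight S R x y z (suc j) ≈ weight S R′ x y z (suc j)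
      same-weight j = ≡⇒≈ (trans (weight≡weightOf R (suc j))
        (trans (cong (λ s → weightOf s (suc j)) (smallest-cong R≐R′ (suc j))) (sym (weight≡weightOf R′ (suc j)))))

    summand-vanishes : ∀ b {R : BRel (suc n)} → ¬ IsEquivalenceᵇ R → summand b R ≈ 0#
    summand-vanishes b {R} ¬eq with isEquivᵇ R in isEquiv
    ... | true  = contradiction (isEquivᵇ⇒IsEquivalence R isEquiv) ¬eq
    ... | false = ≈-refl

    summand-equivalence : ∀ b {R : BRel (suc n)} → IsEquivalenceᵇ R →
                          summand b R ≈ (if numBlocks R ≡ᵇ b then weightProduct R else 0#)
    summand-equivalence b {R} eq rewrite IsEquivalence⇒isEquivᵇ R eq = ≈-refl

    weightOf-inject₁ : (s i : Fin m) → weightOf (inject₁ s) (inject₁ i) ≡ weightOf s i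
    weightOf-inject₁ zero    i = refl
    weightOf-inject₁ (suc s) i = cong (if_then y else z)
      (trans (isYes≗does _) (trans (does-inject₁ (suc s) i) (sym (isYes≗does _))))

    module _ {n} (R : BRel (suc n)) (col row : Fin (suc n) → Bool) (b : Bool)
             (reflexive : ∀ i → Holds R i i) where

      private
        E = extend R col row b

      weight-extend-inject₁ : ∀ i → weight S E x y z (inject₁ i) ≡ weight S R x y z i
      weight-extend-inject₁ i =
        trans (weight≡weightOf E (inject₁ i))
          (trans (cong (λ s → weightOf s (inject₁ i)) (Extend.smallest-old R col row b reflexive i))
            (trans (weightOf-inject₁ (smallest R i) i) (sym (weight≡weightOf R i))))

      weightProduct-extend : weightProduct E ≈ weightProduct R * weight S E x y z (fromℕ (suc n))
      weightProduct-extend = begin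
        ∏ (allFin (suc n)) (λ j → w (suc j))
          ≡⟨ cong (λ js → ∏ js (λ j → w (suc j))) (allFin-suc-∷ʳ n) ⟩
        ∏ (map inject₁ (allFin n) ∷ʳ fromℕ n) (λ j → w (suc j))
          ≈⟨ ∏-++ (map inject₁ (allFin n)) _ _ ⟩
        ∏ (map inject₁ (allFin n)) (λ j → w (suc j)) * (w (fromℕ (suc n)) * 1#)
          ≈⟨ *-cong (≡⇒≈ (∏-map (allFin n) inject₁ _)) (*-identityʳ _) ⟩
        ∏ (allFin n) (λ j → w (inject₁ (suc j))) * w (fromℕ (suc n))
          ≈⟨ *-cong (∏-cong (allFin n) λ j → ≡⇒≈ (weight-extend-inject₁ (suc j))) ≈-refl ⟩
        weightProduct R * w (fromℕ (suc n)) ∎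
        where w = weight S E x y z

    joinWeight : Fin m → Carrier
    joinWeight zero    = x
    joinWeight (suc _) = z

    module _ {n} {R : BRel (suc n)} (eq : IsEquivalenceᵇ R) (b : ℕ) where
      open Equiv eq

      summand-addSingleton :
        summand b (addSingleton R) ≈ (if suc (numBlocks R) ≡ᵇ b then weightProduct R * y else 0#)
      summand-addSingleton = begin
        summand b (addSingleton R)
          ≈⟨ summand-equivalence b (addSingleton-isEquivalence eq) ⟩
        (if numBlocks (addSingleton R) ≡ᵇ b then weightProduct (addSingleton R) else 0#)
          ≡⟨ cong (λ k → if k ≡ᵇ b then weightProduct (addSingleton R) else 0#) (numBlocks-addSingleton eq) ⟩
        (if suc (numBlocks R) ≡ᵇ b then weightProduct (addSingleton R) else 0#)
          ≈⟨ if-cong≈ (suc (numBlocks R) ≡ᵇ b)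
               (≈-trans (weightProduct-extend R _ _ true (λ _ → ∼-refl)) (*-cong ≈-refl (≡⇒≈ new-weight))) ≈-refl ⟩
        (if suc (numBlocks R) ≡ᵇ b then weightProduct R * y else 0#) ∎
        where
        last = fromℕ (suc n)
        new-weight : weight S (addSingleton R) x y z last ≡ y
        new-weight = trans (weight≡weightOf (addSingleton R) last)
          (trans (cong (λ s → weightOf s last) (smallest-addSingleton eq))
                 (cong (if_then y else z) (trans (isYes≗does (last ≟ last)) (dec-true (last ≟ last) refl))))

      summand-addToBlock : ∀ {s} → smallest R s ≡ s →
        summand b (addToBlock R s) ≈ (if numBlocks R ≡ᵇ b then weightProduct R * joinWeight s else 0#)
      summand-addToBlock {s} least = begin
        summand b (addToBlock R s)
          ≈⟨ summand-equivalence b (addToBlock-isEquivalence eq s) ⟩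
        (if numBlocks (addToBlock R s) ≡ᵇ b then weightProduct (addToBlock R s) else 0#)
          ≡⟨ cong (λ k → if k ≡ᵇ b then weightProduct (addToBlock R s) else 0#) (numBlocks-addToBlock eq least) ⟩
        (if numBlocks R ≡ᵇ b then weightProduct (addToBlock R s) else 0#)
          ≈⟨ if-cong≈ (numBlocks R ≡ᵇ b)
               (≈-trans (weightProduct-extend R _ _ true (λ _ → ∼-refl)) (*-cong ≈-refl (≡⇒≈ new-weight))) ≈-refl ⟩
        (if numBlocks R ≡ᵇ b then weightProduct R * joinWeight s else 0#) ∎
        where
        last = fromℕ (suc n)
        joined : ∀ s → weightOf (inject₁ s) last ≡ joinWeight s
        joined zero    = refl
        joined (suc s) = cong (if_then y else z) (trans (isYes≗does _) (does-inject₁-fromℕ (suc s)))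
        new-weight : weight S (addToBlock R s) x y z last ≡ joinWeight s
        new-weight = trans (weight≡weightOf (addToBlock R s) last)
          (trans (cong (λ t → weightOf t last) (smallest-addToBlock eq least)) (joined s))

      ∑-joinWeight : ∑ (representatives R) joinWeight ≈ x + _•_ S (numBlocks R ∸ 1) z
      ∑-joinWeight with smallest R zero ≟ zero
      ... | no  zero-not-least = contradiction (smallest-zero R ∼-refl) zero-not-least
      ... | yes _ = +-cong ≈-refl
        (∑-const (filter least? (tabulate suc)) (AllP.filter⁺ least? (AllP.tabulate⁺ {n = n} {f = suc} λ _ → refl)))
        where least? = λ i → smallest R i ≟ i

    if-*-comm : ∀ t {w a} → (if t then w * a else 0#) ≈ a * (if t then w else 0#)
    if-*-comm true  = *-comm _ _
    if-*-comm false = ≈-sym (zeroʳ _)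

    module _ {n} {R : BRel (suc n)} (eq : IsEquivalenceᵇ R) (b : ℕ) where

      private
        W = weightProduct R
        k = numBlocks R

      joined-summands : (if k ≡ᵇ suc b then W * (x + _•_ S (k ∸ 1) z) else 0#)
                        ≈ (x + _•_ S b z) * (if k ≡ᵇ suc b then W else 0#)
      joined-summands with k ≡ᵇ suc b in k≡b+1
      ... | true rewrite ℕ.≡ᵇ⇒≡ k (suc b) (subst Bool.T (sym k≡b+1) _) = *-comm _ _
      ... | false = ≈-sym (zeroʳ _)

      summand-suc : summand (suc b) (addSingleton R) + ∑ (representatives R) (summand (suc b) ∘ addToBlock R)
                    ≈ y * summand b R + (x + _•_ S b z) * summand (suc b) R
      -- suc k ≡ᵇ suc b computes to k ≡ᵇ b: the singleton term already has the shape of summand b R.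
      summand-suc = begin
        summand (suc b) (addSingleton R) + ∑ reps (summand (suc b) ∘ addToBlock R)
          ≈⟨ +-cong (summand-addSingleton eq (suc b))
                    (∑-cong-∈ reps λ s∈reps →
                       summand-addToBlock eq (suc b) (proj₂ (∈-filter⁻ least? {xs = allFin (suc n)} s∈reps))) ⟩
        (if k ≡ᵇ b then W * y else 0#) + ∑ reps (λ s → if k ≡ᵇ suc b then W * joinWeight s else 0#)
          ≈⟨ +-cong (if-*-comm (k ≡ᵇ b)) sum-joined ⟩
        y * (if k ≡ᵇ b then W else 0#) + (if k ≡ᵇ suc b then W * (x + _•_ S (k ∸ 1) z) else 0#)
          ≈⟨ +-cong (*-cong ≈-refl (≈-sym (summand-equivalence b eq))) joined-summands ⟩
        y * summand b R + (x + _•_ S b z) * (if k ≡ᵇ suc b then W else 0#)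
          ≈⟨ +-cong ≈-refl (*-cong ≈-refl (≈-sym (summand-equivalence (suc b) eq))) ⟩
        y * summand b R + (x + _•_ S b z) * summand (suc b) R ∎
        where
        least? = λ i → smallest R i ≟ i
        reps = representatives R
        sum-joined : ∑ reps (λ s → if k ≡ᵇ suc b then W * joinWeight s else 0#)
                     ≈ (if k ≡ᵇ suc b then W * (x + _•_ S (k ∸ 1) z) else 0#)
        sum-joined with k ≡ᵇ suc b
        ... | true  = ≈-trans (∑-*ˡ reps W joinWeight) (*-cong ≈-refl (∑-joinWeight eq (suc b)))
        ... | false = ∑-zero reps (λ _ → ≈-refl)

    partitionTotal-suc : ∀ n b → partitionTotal (suc n) (suc b)
                                 ≈ y * partitionTotal n b + (x + _•_ S b z) * partitionTotal n (suc b)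
    partitionTotal-suc n b = begin
      ∑ (allBRels (suc (suc n))) (summand (suc b))
        ≈⟨ Decompose.∑-equivalences-suc ⟩
      ∑ Rs (λ R → if isEquivᵇ R then extensions R else 0#)
        ≈⟨ ∑-cong Rs by-cases ⟩
      ∑ Rs (λ R → y * summand b R + (x + _•_ S b z) * summand (suc b) R)
        ≈⟨ ∑-+ Rs _ _ ⟩
      ∑ Rs (λ R → y * summand b R) + ∑ Rs (λ R → (x + _•_ S b z) * summand (suc b) R)
        ≈⟨ +-cong (∑-*ˡ Rs y (summand b)) (∑-*ˡ Rs _ (summand (suc b))) ⟩
      y * partitionTotal n b + (x + _•_ S b z) * partitionTotal n (suc b) ∎
      where
      Rs = allBRels (suc n)
      module Decompose = EquivalenceSums {suc n} (summand (suc b)) (summand-cong (suc b)) (summand-vanishes (suc b))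
      extensions : BRel (suc n) → Carrier
      extensions R = summand (suc b) (addSingleton R) + ∑ (representatives R) (summand (suc b) ∘ addToBlock R)
      by-cases : (R : BRel (suc n)) → (if isEquivᵇ R then extensions R else 0#)
                                      ≈ y * summand b R + (x + _•_ S b z) * summand (suc b) R
      by-cases R with isEquivᵇ R Bool.≟ true
      ... | yes isEquiv = ≈-trans (≡⇒≈ (cong (if_then extensions R else 0#) isEquiv))
                                  (summand-suc (isEquivᵇ⇒IsEquivalence R isEquiv) b)
      ... | no ¬isEquiv = ≈-trans (≡⇒≈ (cong (if_then extensions R else 0#) (¬-not ¬isEquiv)))
                                  (≈-sym (≈-trans (+-cong (*-cong ≈-refl (vanish b)) (*-cong ≈-refl (vanish (suc b))))
                                                  (≈-trans (+-cong (zeroʳ y) (zeroʳ _)) (+-identityˡ 0#))))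
        where vanish = λ b → summand-vanishes b (¬isEquiv ∘ IsEquivalence⇒isEquivᵇ R)

    summand-wrong-count : ∀ {n} b (R : BRel (suc n)) → (numBlocks R ≡ᵇ b) ≡ false → summand b R ≈ 0#
    summand-wrong-count {n} b R wrong rewrite wrong | ∧-zeroʳ (isEquivᵇ {suc n} R) = ≈-refl

    partitionTotal-no-blocks : ∀ n → partitionTotal n 0 ≈ 0#
    partitionTotal-no-blocks n = ∑-zero (allBRels (suc n)) vanish
      where
      vanish : (R : BRel (suc n)) → summand 0 R ≈ 0#
      vanish R with isEquivᵇ R Bool.≟ true
      ... | yes isEquiv = summand-wrong-count 0 R (numBlocks-nonzero (isEquivᵇ⇒IsEquivalence R isEquiv))
      ... | no ¬isEquiv = summand-vanishes 0 (¬isEquiv ∘ IsEquivalence⇒isEquivᵇ R)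

    partitionTotal-too-many-blocks : ∀ n {b} → suc n < b → partitionTotal n b ≈ 0#
    partitionTotal-too-many-blocks n {b} n+1<b = ∑-zero (allBRels (suc n)) λ R →
      summand-wrong-count b R (dec-false (numBlocks R ℕ.≟ b) λ k≡b →
        ℕ.<-irrefl refl (ℕ.≤-<-trans (subst (_≤ suc n) k≡b (numBlocks≤ R)) n+1<b))

    partitionTotal-one-element : partitionTotal 0 1 ≈ 1#
    partitionTotal-one-element = ≈-trans (+-cong ≈-refl (+-identityˡ 0#)) (+-identityʳ 1#)

  module _ (c′ d e : Carrier) where
    open Partitions e c′ d

    T-with-a≡0 : ∀ n k → T S 0# c′ d e n k ≈ partitionTotal n (suc k)
    T-with-a≡0 zero    zero    = ≈-sym partitionTotal-one-element
    T-with-a≡0 zero    (suc k) = ≈-sym (partitionTotal-too-many-blocks 0 {suc (suc k)} (s≤s (s≤s z≤n)))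
    T-with-a≡0 (suc n) zero    = begin
      (0# + e) * T S 0# c′ d e n 0           ≈⟨ *-cong (+-identityˡ e) (T-with-a≡0 n 0) ⟩
      e * partitionTotal n 1                 ≈⟨ +-identityˡ _ ⟨
      0# + e * partitionTotal n 1            ≈⟨ +-cong (zeroʳ c′) (*-cong (+-identityʳ e) ≈-refl) ⟨
      c′ * 0# + (e + 0#) * partitionTotal n 1 ≈⟨ +-cong (*-cong ≈-refl (partitionTotal-no-blocks n)) ≈-refl ⟨
      c′ * partitionTotal n 0 + (e + 0#) * partitionTotal n 1 ≈⟨ partitionTotal-suc n 0 ⟨
      partitionTotal (suc n) 1               ∎
    T-with-a≡0 (suc n) (suc k) = begin
      (_•_ S (n ∸ k) 0# + c′) * T S 0# c′ d e n k + (_•_ S (suc k) d + e) * T S 0# c′ d e n (suc k)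
        ≈⟨ +-cong (*-cong (≈-trans (+-cong (•-zeroʳ (n ∸ k)) ≈-refl) (+-identityˡ c′)) (T-with-a≡0 n k))
                  (*-cong (+-comm _ e) (T-with-a≡0 n (suc k))) ⟩
      c′ * partitionTotal n (suc k) + (e + _•_ S (suc k) d) * partitionTotal n (suc (suc k))
        ≈⟨ partitionTotal-suc n (suc k) ⟨
      partitionTotal (suc n) (suc (suc k)) ∎

  module _ (a c′ e : Carrier) where
    open Partitions c′ e a

    T-with-d≡0 : ∀ n k → T S a c′ 0# e n k ≈ partitionTotal n (suc n ∸ k)
    T-with-d≡0 zero    zero    = ≈-sym partitionTotal-one-element
    T-with-d≡0 zero    (suc k) =
      ≈-sym (≈-trans (≡⇒≈ (cong (partitionTotal 0) (ℕ.0∸n≡0 k))) (partitionTotal-no-blocks 0))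
    T-with-d≡0 (suc n) zero    = begin
      (0# + e) * T S a c′ 0# e n 0                ≈⟨ *-cong (+-identityˡ e) (T-with-d≡0 n 0) ⟩
      e * partitionTotal n (suc n)                ≈⟨ +-identityʳ _ ⟨
      e * partitionTotal n (suc n) + 0#           ≈⟨ +-cong ≈-refl (zeroʳ _) ⟨
      e * partitionTotal n (suc n) + (c′ + _•_ S (suc n) a) * 0#
        ≈⟨ +-cong ≈-refl (*-cong ≈-refl (partitionTotal-too-many-blocks n ℕ.≤-refl)) ⟨
      e * partitionTotal n (suc n) + (c′ + _•_ S (suc n) a) * partitionTotal n (suc (suc n))
        ≈⟨ partitionTotal-suc n (suc n) ⟨
      partitionTotal (suc n) (suc (suc n))        ∎
    T-with-d≡0 (suc n) (suc k) with k ℕ.≤? n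
    ... | yes k≤n = begin
      (_•_ S (n ∸ k) a + c′) * T S a c′ 0# e n k + (_•_ S (suc k) 0# + e) * T S a c′ 0# e n (suc k)
        ≈⟨ +-comm _ _ ⟩
      (_•_ S (suc k) 0# + e) * T S a c′ 0# e n (suc k) + (_•_ S (n ∸ k) a + c′) * T S a c′ 0# e n k
        ≈⟨ +-cong (*-cong (≈-trans (+-cong (•-zeroʳ (suc k)) ≈-refl) (+-identityˡ e)) (T-with-d≡0 n (suc k)))
                  (*-cong (+-comm _ c′) (≈-trans (T-with-d≡0 n k) (≡⇒≈ (cong (partitionTotal n) n+1-k)))) ⟩
      e * partitionTotal n (n ∸ k) + (c′ + _•_ S (n ∸ k) a) * partitionTotal n (suc (n ∸ k))
        ≈⟨ partitionTotal-suc n (n ∸ k) ⟨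
      partitionTotal (suc n) (suc (n ∸ k))
        ≡⟨ cong (partitionTotal (suc n)) n+1-k ⟨
      partitionTotal (suc n) (suc n ∸ k)      ∎
      where
      n+1-k : suc n ∸ k ≡ suc (n ∸ k)
      n+1-k = ℕ.+-∸-assoc 1 k≤n
    ... | no k≰n = begin
      (_•_ S (n ∸ k) a + c′) * T S a c′ 0# e n k + (_•_ S (suc k) 0# + e) * T S a c′ 0# e n (suc k)
        ≈⟨ +-cong (*-cong ≈-refl (≈-trans (T-with-d≡0 n k) (empty n (suc n ∸ k) (ℕ.m≤n⇒m∸n≡0 n<k))))
                  (*-cong ≈-refl (≈-trans (T-with-d≡0 n (suc k)) (empty n (n ∸ k) (ℕ.m≤n⇒m∸n≡0 (ℕ.<⇒≤ n<k))))) ⟩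
      _ * 0# + _ * 0#                          ≈⟨ +-cong (zeroʳ _) (zeroʳ _) ⟩
      0# + 0#                                  ≈⟨ +-identityˡ 0# ⟩
      0#                                       ≈⟨ empty (suc n) (suc n ∸ k) (ℕ.m≤n⇒m∸n≡0 n<k) ⟨
      partitionTotal (suc n) (suc n ∸ k)       ∎
      where
      n<k : suc n ≤ k
      n<k = ℕ.≰⇒> k≰n
      empty : ∀ m b → b ≡ 0 → partitionTotal m b ≈ 0#
      empty m b refl = partitionTotal-no-blocks m

proposition2p1 : {c ℓ : Level} (S : CommutativeSemiring c ℓ) →
    let open CommutativeSemiring S in
    (a c' d e : Carrier) →
      ((n k : ℕ) → T S 0# c' d e n k ≈ partitionSum S n (suc k) e c' d)
      × ((n k : ℕ) → T S a c' 0# e n k ≈ partitionSum S n (suc n ∸ k) c' e a)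
proposition2p1 S a c' d e =
  (λ n k → ≈-trans (T-with-a≡0 c' d e n k) (≈-sym (Partitions.partitionSum≈partitionTotal e c' d n (suc k)))) ,
  (λ n k → ≈-trans (T-with-d≡0 a c' e n k) (≈-sym (Partitions.partitionSum≈partitionTotal c' e a n (suc n ∸ k))))
  where
  open CommutativeSemiring S using () renaming (trans to ≈-trans; sym to ≈-sym)
  open Sums S
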